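{- Let $\mathcal A$ be a finiteness space with $|\mathcal A|\neq\emptyset$. Then the least fixpoint multirelation $\mathrm{fix}_{|\mathcal A|}$ is not finitary in $(\mathcal A\Rightarrow\mathcal A)\Rightarrow\mathcal A$, i.e. $\mathrm{fix}_{|\mathcal A|}\notin\mathfrak F((\mathcal A\Rightarrow\mathcal A)\Rightarrow\mathcal A)$.
   Context: Finiteness spaces $\mathcal A=(|\mathcal A|,\mathfrak F(\mathcal A))$: a set with $\mathfrak F(\mathcal A)\subseteq\mathcal P(|\mathcal A|)$ equal to its bidual, where $\mathfrak A^\perp=\{a': a\cap a'\text{ finite }\forall a\in\mathfrak A\}$; $\mathcal A^\perp=(|\mathcal A|,\mathfrak F(\mathcal A)^\perp)$. $\mathcal M_{\mathrm{fin}}(A)$ denotes finite multisets over $A$, written $[\alpha_1,\dots,\alpha_n]$, with sum $+$, empty multiset $[\,]$, and support $\mathrm{supp}$. The exponential $!\mathcal A$ has web $\mathcal M_{\mathrm{fin}}(|\mathcal A|)$ and finitary subsets those sets $\bar a$ of multisets with $\bigcup_{\bar\alpha\in\bar a}\mathrm{supp}(\bar\alpha)\in\mathfrak F(\mathcal A)$. The tensor $\mathcal A\otimes\mathcal B$ has web $|\mathcal A|\times|\mathcal B|$ and finitary subsets those whose two projections are finitary. $\mathcal A\multimap\mathcal B=(\mathcal A\otimes\mathcal B^\perp)^\perp$ and $\mathcal A\Rightarrow\mathcal B=\,!\mathcal A\multimap\mathcal B$, with web $\mathcal M_{\mathrm{fin}}(|\mathcal A|)\times|\mathcal B|$. For a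 set $A$, writing $A\Rightarrow B=\mathcal M_{\mathrm{fin}}(A)\times B$, define $\mathrm{fix}_0=\emptyset$ and $\mathrm{fix}_{n+1}=\{([([\alpha_1,\dots,\alpha_p],\alpha)]+\sum_{k=1}^p\bar\phi_k,\ \alpha):\ p\in\mathbb N,\ \forall k\in\{1,\dots,p\},\ (\bar\phi_k,\alpha_k)\in\mathrm{fix}_n\}$, and $\mathrm{fix}_A=\bigcup_{n\in\mathbb N}\mathrm{fix}_n\subseteq(A\Rightarrow A)\Rightarrow A$ (the least fixpoint operator of the relational model). -}

module Defs where

open import Level using (0ℓ)
open import Data.Nat using (ℕ; zero; suc)
open import Data.Product using (Σ; ∃; _×_; _,_; proj₁; proj₂)
open import Data.List using (List; []; _∷_; _++_; map; concat)
open import Data.List.Relation.Unary.All using (All)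
open import Data.Empty using (⊥)
open import Relation.Nullary using (¬_)
open import Relation.Binary using (Setoid)
open import Relation.Binary.PropositionalEquality using (_≡_; setoid)
open import Data.Product.Relation.Binary.Pointwise.NonDependent using (×-setoid)
import Data.List.Relation.Binary.Permutation.Setoid as Perm
import Data.List.Membership.Setoid as Mem

-- Webs are setoids: the web of the base space carries propositional
-- equality; webs of finite multisets are lists up to permutation.

Subset : Setoid 0ℓ 0ℓ → Set₁
Subset S = Setoid.Carrier S → Set

Struct : Setoid 0ℓ 0ℓ → Set₂
Struct S = Subset S → Set₁

Finite : (S : Setoid 0ℓ 0ℓ) → Subset S → Set
Finite S a = ∃ λ (xs : List (Setoid.Carrier S)) →
  ∀ x → a x → Mem._∈_ S x xs

_∩_ : {S : Setoid 0ℓ 0ℓ} → Subset S → Subset S → Subset S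
(a ∩ b) x = a x × b x

Orth : (S : Setoid 0ℓ 0ℓ) → Struct S → Struct S
Orth S 𝔉 a' = ∀ a → 𝔉 a → Finite S (_∩_ {S} a a')

Mfin : Setoid 0ℓ 0ℓ → Setoid 0ℓ 0ℓ
Mfin S = Perm.↭-setoid S

_⊗ₛ_ : Setoid 0ℓ 0ℓ → Setoid 0ℓ 0ℓ → Setoid 0ℓ 0ℓ
S ⊗ₛ T = ×-setoid S T

Bang : (S : Setoid 0ℓ 0ℓ) → Struct S → Struct (Mfin S)
Bang S 𝔉 ā = 𝔉 (λ α → ∃ λ m → ā m × Mem._∈_ S α m)

Tensor : (S T : Setoid 0ℓ 0ℓ) → Struct S → Struct T → Struct (S ⊗ₛ T)
Tensor S T 𝔉 𝔊 c =
  𝔉 (λ x → ∃ λ y → c (x , y)) × 𝔊 (λ y → ∃ λ x → c (x , y))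

Lin : (S T : Setoid 0ℓ 0ℓ) → Struct S → Struct T → Struct (S ⊗ₛ T)
Lin S T 𝔉 𝔊 = Orth (S ⊗ₛ T) (Tensor S T 𝔉 (Orth T 𝔊))

_⇒ₛ_ : Setoid 0ℓ 0ℓ → Setoid 0ℓ 0ℓ → Setoid 0ℓ 0ℓ
S ⇒ₛ T = Mfin S ⊗ₛ T

Arr : (S T : Setoid 0ℓ 0ℓ) → Struct S → Struct T → Struct (S ⇒ₛ T)
Arr S T 𝔉 𝔊 = Lin (Mfin S) T (Bang S 𝔉) 𝔊

record FinSpace : Set₂ where
  field
    web : Set
    𝔉 : Struct (setoid web)
    bidual₁ : ∀ a → 𝔉 a → Orth (setoid web) (Orth (setoid web) 𝔉) a
    bidual₂ : ∀ a → Orth (setoid web) (Orth (setoid web) 𝔉) a → 𝔉 a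

-- the least fixpoint multirelation, on list representatives
module _ (A : Set) where
  FixElt : Set
  FixElt = List (List A × A) × A

  data FixN : ℕ → FixElt → Set where
    step : ∀ {n} (α : A) (ks : List FixElt) → All (FixN n) ks →
      FixN (suc n) (((map proj₂ ks , α) ∷ concat (map proj₁ ks)) , α)

  WebA : Setoid 0ℓ 0ℓ
  WebA = setoid A

  WebAA : Setoid 0ℓ 0ℓ
  WebAA = WebA ⇒ₛ WebA

  WebAAA : Setoid 0ℓ 0ℓ
  WebAAA = WebAA ⇒ₛ WebA

  fix : Subset WebAAA
  fix x = ∃ λ n → ∃ λ y → FixN n y × Setoid._≈_ WebAAA y x

Nonempty : Set → Set
Nonempty W = ¬ (W → ⊥)

module Submission where

-- Pick a point α of the web and consider the two points
-- leaf = ([ ] , α) and loop = ([α] , α) of A ⇒ A.  The test set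
--   T = { (m , α) : every element of m is leaf or loop }
-- lies in !(A ⇒ A) ⊗ A^⊥: the supports of its first components are
-- covered by the finite set {leaf , loop}, its second components by {α},
-- and a finite set belongs to every orthogonal.  On the other hand fix
-- contains the towers ([loop, …, loop, leaf] , α) of every height, so
-- fix ∩ T contains multisets of unbounded size and is therefore infinite.
-- Hence fix is not orthogonal to T.
--
-- The argument never
-- uses the bidual condition: it works for an arbitrary family 𝔉.

open import Defs
open import Relation.Nullary using (¬_)
open import Level using (0ℓ)
open import Data.Nat using (ℕ; zero; suc; _≤_; _<_)
open import Data.Nat.Properties using (≤-trans; m≤m+n; m≤n+m; n<1+n; <-irrefl; <-≤-trans)
open import Data.Nat.ListAction using (sum)
open import Data.Product using (∃; _×_; _,_; proj₁; proj₂)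
open import Data.List using (List; []; _∷_; map; length)
open import Data.List.Properties using (++-identityʳ)
open import Data.List.Relation.Unary.All using (All; []; _∷_; lookupₛ)
open import Data.List.Relation.Unary.Any using (here; there)
open import Relation.Binary using (Setoid)
open import Relation.Binary.PropositionalEquality using (_≡_; refl; sym; subst; cong)
import Data.List.Membership.Setoid as Mem
open import Data.List.Membership.Setoid.Properties using (∈-resp-≈)
open import Data.List.Relation.Binary.Permutation.Setoid.Properties using (xs↭ys⇒|xs|≡|ys|)

finite⇒orth : (S : Setoid 0ℓ 0ℓ) (𝔊 : Struct S) (a : Subset S) →
  Finite S a → Orth S 𝔊 a
finite⇒orth S 𝔊 a (xs , covers) b _ = xs , λ x b∩a → covers x (proj₂ b∩a)

module _ (S : Setoid 0ℓ 0ℓ) (size : Setoid.Carrier S → ℕ)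
         (size-resp : ∀ {x y} → Setoid._≈_ S x y → size x ≡ size y) where
  open Mem S using (_∈_)

  size≤total : ∀ {x} xs → x ∈ xs → size x ≤ sum (map size xs)
  size≤total (y ∷ ys) (here x≈y) =
    subst (_≤ sum (map size (y ∷ ys))) (sym (size-resp x≈y)) (m≤m+n (size y) _)
  size≤total (y ∷ ys) (there x∈ys) = ≤-trans (size≤total ys x∈ys) (m≤n+m _ (size y))

  unbounded⇒infinite : (a : Subset S) →
    (∀ n → ∃ λ x → a x × n < size x) → ¬ Finite S a
  unbounded⇒infinite a unbounded (xs , covers)
    with unbounded (sum (map size xs))
  ... | x , ax , total<size =
    <-irrefl refl (<-≤-trans total<size (size≤total xs (covers x ax)))

module _ {A : Set} (α : A) where
  open Mem (WebAA A) using (_∈_)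

  leaf loop : List A × A
  leaf = ([] , α)
  loop = (α ∷ [] , α)

  tower : ℕ → List (List A × A)
  tower zero    = leaf ∷ []
  tower (suc n) = loop ∷ tower n

  length-tower : ∀ n → length (tower n) ≡ suc n
  length-tower zero    = refl
  length-tower (suc n) = cong suc (length-tower n)

  -- the tower of height n is produced at stage n + 1 of the fixpoint:
  -- tower (n + 1) is one step applied to the single premise tower n
  -- (the step's concatenation of premises leaves a trailing ++ [])
  tower∈fix : ∀ n → FixN A (suc n) (tower n , α)
  tower∈fix zero    = step α [] []
  tower∈fix (suc n) =
    subst (λ m → FixN A (suc (suc n)) (loop ∷ m , α)) (++-identityʳ (tower n))
          (step α ((tower n , α) ∷ []) (tower∈fix n ∷ []))

  tower-over : ∀ n → All (_∈ leaf ∷ loop ∷ []) (tower n)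
  tower-over zero    = here (Setoid.refl (WebAA A)) ∷ []
  tower-over (suc n) = there (here (Setoid.refl (WebAA A))) ∷ tower-over n

  Test : Subset (WebAAA A)
  Test (m , y) = All (_∈ leaf ∷ loop ∷ []) m × y ≡ α

  test-finitary : (𝔉 : Struct (WebA A)) →
    Tensor (Mfin (WebAA A)) (WebA A)
      (Bang (WebAA A) (Arr (WebA A) (WebA A) 𝔉 𝔉)) (Orth (WebA A) 𝔉) Test
  test-finitary 𝔉 =
      finite⇒orth (WebAA A)
        (Tensor (Mfin (WebA A)) (WebA A) (Bang (WebA A) 𝔉) (Orth (WebA A) 𝔉))
        supports (leaf ∷ loop ∷ [] , supports-covered)
    , finite⇒orth (WebA A) 𝔉 outputs (α ∷ [] , λ { y (_ , _ , y≡α) → here y≡α })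
    where
      supports : Subset (WebAA A)
      supports e = ∃ λ m → (∃ λ y → Test (m , y)) × e ∈ m

      outputs : Subset (WebA A)
      outputs y = ∃ λ m → Test (m , y)

      supports-covered : ∀ e → supports e → e ∈ leaf ∷ loop ∷ []
      supports-covered e (m , (_ , over , _) , e∈m) =
        lookupₛ (WebAA A) (∈-resp-≈ (WebAA A)) over e∈m

  FixTest : Subset (WebAAA A)
  FixTest = _∩_ {WebAAA A} Test (fix A)

  tower∈FixTest : ∀ n → FixTest (tower n , α)
  tower∈FixTest n =
    (tower-over n , refl) , (suc n , _ , tower∈fix n , Setoid.refl (WebAAA A))

  FixTest-infinite : ¬ Finite (WebAAA A) FixTest
  FixTest-infinite =
    unbounded⇒infinite (WebAAA A) (λ z → length (proj₁ z))
      (λ m≈m′ → xs↭ys⇒|xs|≡|ys| (WebAA A) (proj₁ m≈m′)) FixTest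
      (λ n → (tower n , α) , tower∈FixTest n
           , subst (n <_) (sym (length-tower n)) (n<1+n n))

  fix-not-finitary : (𝔉 : Struct (WebA A)) →
    ¬ Arr (WebAA A) (WebA A) (Arr (WebA A) (WebA A) 𝔉 𝔉) 𝔉 (fix A)
  fix-not-finitary 𝔉 fix-finitary =
    FixTest-infinite (fix-finitary Test (test-finitary 𝔉))

-- The web is only known to be nonempty in the double-negated sense,
-- which suffices since the goal is a negation.
lemma17 : (𝒜 : FinSpace) → Nonempty (FinSpace.web 𝒜) →
    ¬ Arr (WebAA (FinSpace.web 𝒜)) (WebA (FinSpace.web 𝒜))
    (Arr (WebA (FinSpace.web 𝒜)) (WebA (FinSpace.web 𝒜)) (FinSpace.𝔉 𝒜) (FinSpace.𝔉 𝒜))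
    (FinSpace.𝔉 𝒜) (fix (FinSpace.web 𝒜))
lemma17 𝒜 nonempty fix-finitary =
  nonempty (λ α → fix-not-finitary α (FinSpace.𝔉 𝒜) fix-finitary)
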